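{- Let $G=(V,E)$ be a graph of order $n$, let $G^Y$ be the GY4-graph corresponding to $G$, and let $k\le n$ be a positive integer. Then $G$ has a dominating set of cardinality at most $k$ if and only if $G^Y$ has a dominating set of cardinality at most $k+n$.
   Context: All graphs are finite, simple and undirected. A set $D$ of vertices is a dominating set if every vertex not in $D$ has a neighbour in $D$. GY4-graph: let $G=(V,E)$ be a graph with $V=\{v_1,\dots,v_n\}$. For each $i$, take a new star $S^4_i$ on four vertices, with centre $v_i^4$ and leaves $v_i^1,v_i^2,v_i^3$. The graph $G^Y$ obtained from the disjoint union of $G$ and $S^4_1,\dots,S^4_n$ by adding the edges $v_iv_i^1$ for $1\le i\le n$ is the GY4-graph corresponding to $G$. -}

module Defs where

open import Data.Nat using (ℕ; _+_; _*_; _≤_)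
open import Data.Fin using (Fin; zero; suc; splitAt; remQuot)
open import Data.Fin.Subset using (Subset; _∈_; ∣_∣)
open import Data.Sum using (_⊎_; inj₁; inj₂)
open import Data.Product using (_×_; _,_; Σ; ∃-syntax)
open import Data.Empty using (⊥)
open import Data.Unit using (⊤)
open import Relation.Binary.PropositionalEquality using (_≡_)
open import Relation.Nullary using (¬_)
open import Level using (0ℓ)

record Graph (n : ℕ) : Set₁ where
  field
    Adj     : Fin n → Fin n → Set
    sym     : ∀ {u v} → Adj u v → Adj v u
    irrefl  : ∀ {v} → ¬ Adj v v

open Graph public

IsDominating : ∀ {n} → Graph n → Subset n → Set
IsDominating G D = ∀ v → ¬ (v ∈ D) → ∃[ u ] (u ∈ D × Adj G u v)

HasDomSetOfSizeAtMost : ∀ {n} → Graph n → ℕ → Set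
HasDomSetOfSizeAtMost {n} G k =
  ∃[ D ] (IsDominating G D × ∣ D ∣ ≤ k)

-- Vertices of the GY4-graph of a graph on Fin n: Fin (n + n * 4).
-- inj₁ i  (via splitAt) is the original vertex v_i;
-- inj₂ c with remQuot 4 c = (i , j) is the star vertex of S^4_i:
--   j = 0,1,2  are the leaves v_i^1, v_i^2, v_i^3,  j = 3 is the centre v_i^4.

StarAdj : Fin 4 → Fin 4 → Set
StarAdj (suc (suc (suc zero))) (suc (suc (suc zero))) = ⊥
StarAdj (suc (suc (suc zero))) _ = ⊤
StarAdj _ (suc (suc (suc zero))) = ⊤
StarAdj _ _ = ⊥

YAdj : ∀ {n} → Graph n → Fin n ⊎ (Fin n × Fin 4) → Fin n ⊎ (Fin n × Fin 4) → Set
YAdj G (inj₁ u) (inj₁ v) = Adj G u v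
YAdj G (inj₁ u) (inj₂ (i , j)) = (u ≡ i) × (j ≡ zero)
YAdj G (inj₂ (i , j)) (inj₁ u) = (u ≡ i) × (j ≡ zero)
YAdj G (inj₂ (i , j)) (inj₂ (i' , j')) = (i ≡ i') × StarAdj j j'

label : ∀ {n} → Fin (n + n * 4) → Fin n ⊎ (Fin n × Fin 4)
label {n} x with splitAt n x
... | inj₁ i = inj₁ i
... | inj₂ c = inj₂ (remQuot 4 c)

private
  StarAdj-sym : ∀ {a b} → StarAdj a b → StarAdj b a
  StarAdj-sym {zero} {suc (suc (suc zero))} p = p
  StarAdj-sym {suc zero} {suc (suc (suc zero))} p = p
  StarAdj-sym {suc (suc zero)} {suc (suc (suc zero))} p = p
  StarAdj-sym {suc (suc (suc zero))} {zero} p = p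
  StarAdj-sym {suc (suc (suc zero))} {suc zero} p = p
  StarAdj-sym {suc (suc (suc zero))} {suc (suc zero)} p = p
  StarAdj-sym {suc (suc (suc zero))} {suc (suc (suc zero))} ()

  StarAdj-irr : ∀ {a} → ¬ StarAdj a a
  StarAdj-irr {suc (suc (suc zero))} ()

  YAdj-sym : ∀ {n} (G : Graph n) {x y} → YAdj G x y → YAdj G y x
  YAdj-sym G {inj₁ u} {inj₁ v} p = sym G p
  YAdj-sym G {inj₁ u} {inj₂ _} p = p
  YAdj-sym G {inj₂ _} {inj₁ u} p = p
  YAdj-sym G {inj₂ _} {inj₂ _} (e , p) = Eq.sym e , StarAdj-sym p
    where import Relation.Binary.PropositionalEquality as Eq

  YAdj-irr : ∀ {n} (G : Graph n) {x} → ¬ YAdj G x x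
  YAdj-irr G {inj₁ u} p = irrefl G p
  YAdj-irr G {inj₂ _} (_ , p) = StarAdj-irr p

GY4 : ∀ {n} → Graph n → Graph (n + n * 4)
GY4 G = record
  { Adj    = λ x y → YAdj G (label x) (label y)
  ; sym    = λ {x} {y} → YAdj-sym G {label x} {label y}
  ; irrefl = λ {x} → YAdj-irr G {label x}
  }

-- Adding the n star centres to a dominating set of G dominates G^Y, since
-- every leaf hangs off its centre.  Conversely, let D' dominate G^Y.  The
-- leaf v_i^2 is adjacent only to the centre v_i^4, so D' contains a vertex
-- of S^4_i other than v_i^1.  The only star vertex with a neighbour in G is
-- v_i^1, adjacent to v_i alone, so moving v_i^1 to v_i and dropping the
-- stars yields a dominating set of G, of size at most ∣D'∣ - n.
module Submission where

open import Defs hiding (sym)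
open import Data.Nat using (ℕ; zero; suc; _+_; _*_; _≤_; _<_; z≤n; s≤s)
open import Data.Nat.Properties
  using (≤-trans; ≤-reflexive; +-mono-≤; +-monoˡ-≤; +-monoʳ-≤; +-suc; +-assoc; +-cancelʳ-≤; *-identityʳ; module ≤-Reasoning)
open import Data.Fin using (Fin; zero; suc; _↑ˡ_; _↑ʳ_; splitAt; combine)
open import Data.Fin.Properties using (splitAt-↑ˡ; splitAt-↑ʳ; join-splitAt; remQuot-combine; combine-remQuot)
open import Data.Fin.Subset using (Subset; inside; outside; _∈_; _∉_; _∪_; ⁅_⁆; ∣_∣)
open import Data.Fin.Subset.Properties using (∣p∣≤∣x∷p∣; x∈⁅x⁆; x∈p∪q⁺; _∈?_)
open import Data.Fin.Patterns using (0F; 1F; 2F; 3F)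
open import Data.Vec as Vec using (Vec; []; _∷_; _++_; concat; replicate; map; head; lookup; here; there)
open import Data.Vec.Properties using ([]=⇒lookup; lookup⇒[]=; lookup-++ˡ; lookup-++ʳ; lookup-concat; lookup-replicate; lookup-map)
open import Data.Sum using (_⊎_; inj₁; inj₂)
open import Data.Product using (_×_; _,_; ∃-syntax; ∃₂)
open import Data.Empty using (⊥-elim)
open import Data.Unit using (tt)
open import Function.Bundles using (_⇔_; mk⇔; Equivalence)
open import Relation.Binary.PropositionalEquality
  using (_≡_; refl; sym; trans; cong; subst)
open import Relation.Nullary using (¬_; yes; no)

∣p++q∣≡∣p∣+∣q∣ : ∀ {m n} (p : Subset m) (q : Subset n) → ∣ p ++ q ∣ ≡ ∣ p ∣ + ∣ q ∣
∣p++q∣≡∣p∣+∣q∣ []            q = refl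
∣p++q∣≡∣p∣+∣q∣ (inside  ∷ p) q = cong suc (∣p++q∣≡∣p∣+∣q∣ p q)
∣p++q∣≡∣p∣+∣q∣ (outside ∷ p) q = ∣p++q∣≡∣p∣+∣q∣ p q

∣p∪q∣≤∣p∣+∣q∣ : ∀ {n} (p q : Subset n) → ∣ p ∪ q ∣ ≤ ∣ p ∣ + ∣ q ∣
∣p∪q∣≤∣p∣+∣q∣ []            []            = z≤n
∣p∪q∣≤∣p∣+∣q∣ (inside  ∷ p) (x ∷ q)       = s≤s (≤-trans (∣p∪q∣≤∣p∣+∣q∣ p q) (+-monoʳ-≤ ∣ p ∣ (∣p∣≤∣x∷p∣ x q)))
∣p∪q∣≤∣p∣+∣q∣ (outside ∷ p) (inside  ∷ q) = ≤-trans (s≤s (∣p∪q∣≤∣p∣+∣q∣ p q)) (≤-reflexive (sym (+-suc ∣ p ∣ ∣ q ∣)))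
∣p∪q∣≤∣p∣+∣q∣ (outside ∷ p) (outside ∷ q) = ∣p∪q∣≤∣p∣+∣q∣ p q

x∈p⇒0<∣p∣ : ∀ {n} {x : Fin n} {p : Subset n} → x ∈ p → 0 < ∣ p ∣
x∈p⇒0<∣p∣ here                  = s≤s z≤n
x∈p⇒0<∣p∣ {p = y ∷ p} (there x∈p) = ≤-trans (x∈p⇒0<∣p∣ x∈p) (∣p∣≤∣x∷p∣ y p)

∣concat-replicate∣ : ∀ n {k} (p : Subset k) → ∣ concat (replicate n p) ∣ ≡ n * ∣ p ∣
∣concat-replicate∣ zero    p = refl
∣concat-replicate∣ (suc n) p = trans (∣p++q∣≡∣p∣+∣q∣ p _) (cong (∣ p ∣ +_) (∣concat-replicate∣ n p))

-- The member of each block beyond its head pays for the  + n.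
∣map-head∣+n≤∣concat∣ : ∀ {n k} (xss : Vec (Subset (suc k)) n) →
  (∀ i → ∃[ j ] suc j ∈ lookup xss i) → ∣ map head xss ∣ + n ≤ ∣ concat xss ∣
∣map-head∣+n≤∣concat∣ []              _ = z≤n
∣map-head∣+n≤∣concat∣ {suc n} ((x ∷ p) ∷ xss) tails with tails zero
... | j , there j∈p = headCase x
  where
  open ≤-Reasoning
  rest : ∣ map head xss ∣ + suc n ≤ ∣ p ++ concat xss ∣
  rest = begin
    ∣ map head xss ∣ + suc n   ≡⟨ +-suc _ n ⟩
    1 + (∣ map head xss ∣ + n) ≤⟨ +-mono-≤ (x∈p⇒0<∣p∣ j∈p) (∣map-head∣+n≤∣concat∣ xss (λ i → tails (suc i))) ⟩
    ∣ p ∣ + ∣ concat xss ∣     ≡⟨ sym (∣p++q∣≡∣p∣+∣q∣ p (concat xss)) ⟩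
    ∣ p ++ concat xss ∣        ∎
  headCase : ∀ x → ∣ x ∷ map head xss ∣ + suc n ≤ ∣ x ∷ (p ++ concat xss) ∣
  headCase inside  = s≤s rest
  headCase outside = rest

∣p∪map-head∣+n≤∣p++concat∣ : ∀ {n k} (p : Subset n) (xss : Vec (Subset (suc k)) n) →
  (∀ i → ∃[ j ] suc j ∈ lookup xss i) → ∣ p ∪ map head xss ∣ + n ≤ ∣ p ++ concat xss ∣
∣p∪map-head∣+n≤∣p++concat∣ {n} p xss tails = begin
  ∣ p ∪ map head xss ∣ + n           ≤⟨ +-monoˡ-≤ n (∣p∪q∣≤∣p∣+∣q∣ p (map head xss)) ⟩
  ∣ p ∣ + ∣ map head xss ∣ + n       ≡⟨ +-assoc ∣ p ∣ _ n ⟩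
  ∣ p ∣ + (∣ map head xss ∣ + n)     ≤⟨ +-monoʳ-≤ ∣ p ∣ (∣map-head∣+n≤∣concat∣ xss tails) ⟩
  ∣ p ∣ + ∣ concat xss ∣             ≡⟨ sym (∣p++q∣≡∣p∣+∣q∣ p (concat xss)) ⟩
  ∣ p ++ concat xss ∣                ∎
  where open ≤-Reasoning

head≡inside : ∀ {k} {p : Subset (suc k)} → zero ∈ p → head p ≡ inside
head≡inside here = refl

zero∈⇒∈map-head : ∀ {n k} (xss : Vec (Subset (suc k)) n) i → zero ∈ lookup xss i → i ∈ map head xss
zero∈⇒∈map-head xss i 0∈ = lookup⇒[]= i (map head xss) (trans (lookup-map i head xss) (head≡inside 0∈))

∈-resp-lookup : ∀ {m n} {p : Subset m} {q : Subset n} {x y} →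
  lookup p x ≡ lookup q y → x ∈ p → y ∈ q
∈-resp-lookup {q = q} {y = y} eq x∈p = lookup⇒[]= y q (trans (sym eq) ([]=⇒lookup x∈p))

++-concat-view : ∀ {a} {A : Set a} m {n k} (xs : Vec A (m + n * k)) →
  ∃₂ λ ys (yss : Vec (Vec A k) n) → xs ≡ ys ++ concat yss
++-concat-view m {n} {k} xs with Vec.splitAt m xs
... | ys , zs , refl with Vec.group n k zs
...   | yss , refl = ys , yss , refl

YVertex : ℕ → Set
YVertex n = Fin n ⊎ (Fin n × Fin 4)

unlabel : ∀ {n} → YVertex n → Fin (n + n * 4)
unlabel {n} (inj₁ i)       = i ↑ˡ (n * 4)
unlabel {n} (inj₂ (i , j)) = n ↑ʳ combine i j

label-unlabel : ∀ {n} (y : YVertex n) → label (unlabel y) ≡ y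
label-unlabel {n} (inj₁ i) rewrite splitAt-↑ˡ n i (n * 4) = refl
label-unlabel {n} (inj₂ (i , j)) rewrite splitAt-↑ʳ n (n * 4) (combine i j) =
  cong inj₂ (remQuot-combine i j)

unlabel-label : ∀ {n} (x : Fin (n + n * 4)) → unlabel (label {n} x) ≡ x
unlabel-label {n} x with splitAt n x | join-splitAt n (n * 4) x
... | inj₁ i | eq = eq
... | inj₂ c | eq = trans (cong (n ↑ʳ_) (combine-remQuot {n} 4 c)) eq

-- A subset of V(G^Y) presented as  xs ++ concat xss : xs on the vertices
-- of G and  lookup xss i  on the star S^4_i.
YMember : ∀ {n} → Subset n → Vec (Subset 4) n → YVertex n → Set
YMember xs xss (inj₁ i)       = i ∈ xs
YMember xs xss (inj₂ (i , j)) = j ∈ lookup xss i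

lookup-unlabel : ∀ {n} (xs : Subset n) (xss : Vec (Subset 4) n) (i : Fin n) (j : Fin 4) →
  lookup (xs ++ concat xss) (unlabel (inj₂ (i , j))) ≡ lookup (lookup xss i) j
lookup-unlabel xs xss i j = trans (lookup-++ʳ xs (concat xss) (combine i j)) (lookup-concat xss i j)

unlabel-∈⇔ : ∀ {n} (xs : Subset n) xss (y : YVertex n) →
  unlabel y ∈ xs ++ concat xss ⇔ YMember xs xss y
unlabel-∈⇔ xs xss (inj₁ i) = mk⇔
  (∈-resp-lookup (lookup-++ˡ xs (concat xss) i))
  (∈-resp-lookup (sym (lookup-++ˡ xs (concat xss) i)))
unlabel-∈⇔ xs xss (inj₂ (i , j)) = mk⇔
  (∈-resp-lookup (lookup-unlabel xs xss i j))
  (∈-resp-lookup (sym (lookup-unlabel xs xss i j)))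

module _ {n} (G : Graph n) where

  Dominates : (YVertex n → Set) → Set
  Dominates P = ∀ y → ¬ P y → ∃[ z ] (P z × YAdj G z y)

  isDominating⇔dominates : (xs : Subset n) (xss : Vec (Subset 4) n) →
    IsDominating (GY4 G) (xs ++ concat xss) ⇔ Dominates (YMember xs xss)
  isDominating⇔dominates xs xss = mk⇔ to from
    where
    open Equivalence using () renaming (to to ⇒; from to ⇐)
    D' = xs ++ concat xss
    to : IsDominating (GY4 G) D' → Dominates (YMember xs xss)
    to dom y y∉ with dom (unlabel y) (λ y∈ → y∉ (⇒ (unlabel-∈⇔ xs xss y) y∈))
    ... | u , u∈ , u~y =
      label {n} u ,
      ⇒ (unlabel-∈⇔ xs xss (label {n} u)) (subst (_∈ D') (sym (unlabel-label {n} u)) u∈) ,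
      subst (YAdj G (label {n} u)) (label-unlabel y) u~y
    from : Dominates (YMember xs xss) → IsDominating (GY4 G) D'
    from dom x x∉ with dom (label {n} x) (λ x∈ →
                         x∉ (subst (_∈ D') (unlabel-label {n} x) (⇐ (unlabel-∈⇔ xs xss (label {n} x)) x∈)))
    ... | z , z∈ , z~x =
      unlabel z ,
      ⇐ (unlabel-∈⇔ xs xss z) z∈ ,
      subst (λ w → YAdj G w (label {n} x)) (sym (label-unlabel z)) z~x

  centres-dominate : ∀ {D} → IsDominating G D → Dominates (YMember D (replicate n ⁅ 3F ⁆))
  centres-dominate dom (inj₁ i) i∉ with dom i i∉
  ... | u , u∈ , u~i = inj₁ u , u∈ , u~i
  centres-dominate dom (inj₂ (i , j)) j∉ = inj₂ (i , 3F) , centre∈ , refl , centre~ j j∉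
    where
    centre∈ : 3F ∈ lookup (replicate n ⁅ 3F ⁆) i
    centre∈ = subst (3F ∈_) (sym (lookup-replicate i ⁅ 3F ⁆)) (x∈⁅x⁆ 3F)
    centre~ : ∀ j → j ∉ lookup (replicate n ⁅ 3F ⁆) i → StarAdj 3F j
    centre~ 0F _   = tt
    centre~ 1F _   = tt
    centre~ 2F _   = tt
    centre~ 3F 3∉ = ⊥-elim (3∉ centre∈)

  -- v_i^2 is adjacent only to v_i^4, so one of them lies in the set.
  stars-meet : ∀ {xs xss} → Dominates (YMember xs xss) → ∀ i → ∃[ j ] suc j ∈ lookup xss i
  stars-meet {xss = xss} dom i with 1F ∈? lookup xss i
  ... | yes 1∈ = 0F , 1∈
  ... | no 1∉ with dom (inj₂ (i , 1F)) 1∉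
  ...   | inj₁ _ , _ , _ , ()
  ...   | inj₂ (_ , 0F) , _ , _ , ()
  ...   | inj₂ (_ , 1F) , _ , _ , ()
  ...   | inj₂ (_ , 2F) , _ , _ , ()
  ...   | inj₂ (_ , 3F) , 3∈ , refl , _ = 2F , 3∈

  -- A star vertex dominating v_i can only be v_i^1, which is replaced by v_i.
  project-dominates : ∀ {xs xss} → Dominates (YMember xs xss) → IsDominating G (xs ∪ map head xss)
  project-dominates {xs} {xss} dom i i∉ with dom (inj₁ i) (λ i∈ → i∉ (x∈p∪q⁺ (inj₁ i∈)))
  ... | inj₁ w , w∈ , w~i = w , x∈p∪q⁺ (inj₁ w∈) , w~i
  ... | inj₂ (_ , _) , 0∈ , refl , refl = ⊥-elim (i∉ (x∈p∪q⁺ (inj₂ (zero∈⇒∈map-head xss i 0∈))))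

  add-centres : ∀ {k} → HasDomSetOfSizeAtMost G k → HasDomSetOfSizeAtMost (GY4 G) (k + n)
  add-centres {k} (D , dom , ∣D∣≤k) =
    D ++ concat centres , Equivalence.from (isDominating⇔dominates D centres) (centres-dominate dom) , size
    where
    centres : Vec (Subset 4) n
    centres = replicate n ⁅ 3F ⁆
    open ≤-Reasoning
    size : ∣ D ++ concat centres ∣ ≤ k + n
    size = begin
      ∣ D ++ concat centres ∣     ≡⟨ ∣p++q∣≡∣p∣+∣q∣ D (concat centres) ⟩
      ∣ D ∣ + ∣ concat centres ∣  ≡⟨ cong (∣ D ∣ +_) (∣concat-replicate∣ n ⁅ 3F ⁆) ⟩
      ∣ D ∣ + n * 1               ≡⟨ cong (∣ D ∣ +_) (*-identityʳ n) ⟩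
      ∣ D ∣ + n                   ≤⟨ +-monoˡ-≤ n ∣D∣≤k ⟩
      k + n                       ∎

  remove-stars : ∀ {k} → HasDomSetOfSizeAtMost (GY4 G) (k + n) → HasDomSetOfSizeAtMost G k
  remove-stars {k} (D' , dom , size) with ++-concat-view n {n} {4} D'
  ... | xs , xss , refl =
    xs ∪ map head xss ,
    project-dominates dom' ,
    +-cancelʳ-≤ n _ k (≤-trans (∣p∪map-head∣+n≤∣p++concat∣ xs xss (stars-meet dom')) size)
    where
    dom' = Equivalence.to (isDominating⇔dominates xs xss) dom

mainTheorem7 : ∀ {n : ℕ} (G : Graph n) (k : ℕ) → 0 < k → k ≤ n →
    (HasDomSetOfSizeAtMost G k ⇔ HasDomSetOfSizeAtMost (GY4 G) (k + n))
mainTheorem7 G k _ _ = mk⇔ (add-centres G) (remove-stars G)
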